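{- Let $s$ be a positive integer and let $F(s)$ denote the set of positive integers $n$ such that $(s,p,n)$ is admissible for some positive integer $p$. If $n$ is a positive integer with $n\in F(s)$, then for all positive integers $s'$ and $n'$ with $n'\leq s'$, we have $n+n'\in F(s+s')$.
   Context: For a multiset $\{x_1,\dots,x_n\}$ of positive integers define $T\{x_1,\dots,x_n\}=(x_1+\cdots+x_n,\,x_1x_2\cdots x_n,\,n)$. An ordered triple $(s,p,n)$ of positive integers is called admissible if there exist at least two different multisets $X$, $Y$ of $n$ positive integers with $T(X)=T(Y)=(s,p,n)$. -}

module Defs where

open import Data.Nat using (ℕ; _≤_; _+_)
open import Data.List using (List; length)
open import Data.Nat.ListAction using (sum; product)
open import Data.List.Relation.Unary.All using (All)
open import Data.List.Relation.Binary.Permutation.Propositional using (_↭_)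
open import Data.Product using (_×_; ∃-syntax)
open import Relation.Binary.PropositionalEquality using (_≡_)
open import Relation.Nullary using (¬_)

-- A multiset of positive integers is represented by a list of positive
-- naturals; two lists represent the same multiset iff they are permutations.
Positive : List ℕ → Set
Positive X = All (λ x → 1 ≤ x) X

HasT : List ℕ → ℕ → ℕ → ℕ → Set
HasT X s p n = (sum X ≡ s) × (product X ≡ p) × (length X ≡ n)

Admissible : ℕ → ℕ → ℕ → Set
Admissible s p n =
  ∃[ X ] ∃[ Y ] Positive X × Positive Y × HasT X s p n × HasT Y s p n × ¬ (X ↭ Y)

InF : ℕ → ℕ → Set
InF s n = (1 ≤ n) × ∃[ p ] ((1 ≤ p) × Admissible s p n)

{-# OPTIONS --safe #-}
module Submission where

open import Defs
open import Data.Nat using (ℕ; suc; _≤_; _+_; _*_; s≤s; z≤n; >-nonZero; >-nonZero⁻¹)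
open import Data.Nat.Properties
  using (+-comm; *-identityʳ; *-mono-≤; ≤-trans; m≤n+m; m≤n⇒∃[o]m+o≡n)
open import Data.Nat.ListAction using (sum; product)
open import Data.Nat.ListAction.Properties using (sum-++; product-++; product≢0)
open import Data.List using (List; []; _∷_; _++_; length; replicate)
open import Data.List.Properties using (length-++; length-replicate)
open import Data.List.Relation.Unary.All using ([]; _∷_)
import Data.List.Relation.Unary.All as All
open import Data.List.Relation.Unary.All.Properties using (++⁺)
open import Data.List.Relation.Binary.Permutation.Propositional using (_↭_)
open import Data.List.Relation.Binary.Permutation.Propositional.Properties using (drop-∷)
open import Data.Product using (_×_; _,_; ∃-syntax)
open import Relation.Binary.PropositionalEquality using (_≡_; refl; cong; subst₂; module ≡-Reasoning)
open ≡-Reasoning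

-- Prepending a fixed positive multiset Z to both witnesses of an admissible
-- triple keeps them distinct, so F(s) + n' ⊆ F(s + s') as soon as some
-- multiset of n' positive integers has sum s', e.g. (s' − n' + 1, 1, …, 1).

↭-cancelˡ : ∀ {A : Set} (Z : List A) {X Y : List A} → Z ++ X ↭ Z ++ Y → X ↭ Y
↭-cancelˡ []      h = h
↭-cancelˡ (_ ∷ Z) h = ↭-cancelˡ Z (drop-∷ h)

product-positive : ∀ {X} → Positive X → 1 ≤ product X
product-positive pX = >-nonZero⁻¹ _ {{product≢0 (All.map >-nonZero pX)}}

sum-replicate : ∀ m x → sum (replicate m x) ≡ m * x
sum-replicate 0       x = refl
sum-replicate (suc m) x = cong (x +_) (sum-replicate m x)

replicate-positive : ∀ m {x} → 1 ≤ x → Positive (replicate m x)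
replicate-positive 0       _   = []
replicate-positive (suc m) 1≤x = 1≤x ∷ replicate-positive m 1≤x

positive-with-sum-length : ∀ {s n} → 1 ≤ n → n ≤ s →
  ∃[ Z ] Positive Z × sum Z ≡ s × length Z ≡ n
positive-with-sum-length {s} {suc m} _ m<s with m≤n⇒∃[o]m+o≡n m<s
... | k , 1+m+k≡s =
  suc k ∷ replicate m 1 , s≤s z≤n ∷ replicate-positive m (s≤s z≤n) ,
  sum-Z , cong suc (length-replicate m)
  where
  sum-Z : suc k + sum (replicate m 1) ≡ s
  sum-Z = begin
    suc k + sum (replicate m 1) ≡⟨ cong (suc k +_) (sum-replicate m 1) ⟩
    suc k + m * 1               ≡⟨ cong (suc k +_) (*-identityʳ m) ⟩
    suc (k + m)                 ≡⟨ cong suc (+-comm k m) ⟩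
    suc (m + k)                 ≡⟨ 1+m+k≡s ⟩
    s                           ∎

HasT-++ : ∀ Z X {s p n} → HasT X s p n →
  HasT (Z ++ X) (sum Z + s) (product Z * p) (length Z + n)
HasT-++ Z X (refl , refl , refl) = sum-++ Z X , product-++ Z X , length-++ Z

Admissible-++ : ∀ {Z s p n} → Positive Z → Admissible s p n →
  Admissible (sum Z + s) (product Z * p) (length Z + n)
Admissible-++ {Z} pZ (X , Y , pX , pY , tX , tY , X≁Y) =
  Z ++ X , Z ++ Y , ++⁺ pZ pX , ++⁺ pZ pY , HasT-++ Z X tX , HasT-++ Z Y tY ,
  λ h → X≁Y (↭-cancelˡ Z h)

InF-++ : ∀ {Z s n} → Positive Z → InF s n → InF (sum Z + s) (length Z + n)
InF-++ {Z} {n = n} pZ (1≤n , p , 1≤p , adm) =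
  ≤-trans 1≤n (m≤n+m n (length Z)) ,
  product Z * p , *-mono-≤ (product-positive pZ) 1≤p , Admissible-++ pZ adm

lemma2p3 : (s n : ℕ) → 1 ≤ s → 1 ≤ n → InF s n →
    (s' n' : ℕ) → 1 ≤ s' → 1 ≤ n' → n' ≤ s' → InF (s + s') (n + n')
lemma2p3 s n _ _ n∈F s' n' _ 1≤n' n'≤s'
  with positive-with-sum-length 1≤n' n'≤s'
... | Z , pZ , refl , refl =
  subst₂ InF (+-comm (sum Z) s) (+-comm (length Z) n) (InF-++ pZ n∈F)
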